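{- Let $L$ be a nonempty set and $B\subseteq L$. For $X\subseteq L$ let $C(X,B)\colon\mathcal P(L)\to\mathcal P(L)$ be given by $C(X,B)(A)=A\cup X$ if $A\cap B\neq\emptyset$ and $C(X,B)(A)=A$ if $A\cap B=\emptyset$, and let $\mathcal C(B)=\{C(X,B): X\subseteq L\}$. Then $\mathcal C(B)\subseteq\mathcal C_f$, on $\mathcal C(B)$ the pointwise join $\vee$ coincides with $\vee_w$, and $\langle\mathcal C(B),\wedge,\vee,I,C(L,B)\rangle$ is a complete and distributive sublattice of $\langle\mathcal C_f,\wedge,\vee_w,I,U\rangle$ (with least element $I$ and greatest element $C(L,B)$). Moreover, if there exist nonempty $A,B\subseteq L$ with $A\neq L$, $B\subseteq A$ and $B\neq A$, then (for this $B$) $\langle\mathcal C(B),\wedge,\vee,I,C(L,B)\rangle$ is not a chain.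
   Context: A consequence operator on a nonempty set $L$ is a map $C\colon\mathcal P(L)\to\mathcal P(L)$ such that for all $X,Y\subseteq L$: $X\subseteq C(X)=C(C(X))\subseteq L$, and $X\subseteq Y$ implies $C(X)\subseteq C(Y)$; it is finite if $C(X)=\bigcup\{C(A): A \text{ finite}, A\subseteq X\}$ for all $X$. $\mathcal C_f$ is the set of finite consequence operators on $L$, ordered by $C_1\le C_2$ iff $C_1(X)\subseteq C_2(X)$ for all $X$. $I$ is the identity on $\mathcal P(L)$ and $U$ is the constant map $X\mapsto L$. For operators $C_1,C_2$: $(C_1\wedge C_2)(X)=C_1(X)\cap C_2(X)$; $(C_1\vee C_2)(X)=C_1(X)\cup C_2(X)$; $(C_1\vee_w C_2)(X)=\bigcap\{Y: X\subseteq Y\subseteq L,\ Y=C_1(Y)=C_2(Y)\}$. -}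

module Defs where

open import Level using (0ℓ) renaming (suc to lsuc)
open import Data.Product using (Σ; ∃; _×_; _,_)
open import Data.Sum using (_⊎_)
open import Data.List using (List)
open import Data.List.Membership.Propositional using () renaming (_∈_ to _∈ₗ_)
open import Data.List.Relation.Unary.All using (All)
open import Relation.Nullary using (¬_)
open import Relation.Unary using (Pred; _⊆_; _≐_; _∩_; _∪_; Empty; ∅)

Sub : Set → Set₁
Sub L = Pred L 0ℓ

Op : Set → Set₁
Op L = Sub L → Sub L

⟦_⟧ : {L : Set} → List L → Sub L
⟦ xs ⟧ = λ y → y ∈ₗ xs

record IsConsequenceOp {L : Set} (C : Op L) : Set₁ where
  field
    extensive : ∀ X → X ⊆ C X
    idempotent : ∀ X → C (C X) ≐ C X
    monotone : ∀ X Y → X ⊆ Y → C X ⊆ C Y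

-- C(X) = ⋃ { C(A) : A finite, A ⊆ X }  (finite subsets = sets of entries of lists).
IsFiniteOp : {L : Set} → Op L → Set₁
IsFiniteOp {L} C = ∀ X → C X ≐ (λ x → Σ (List L) λ xs → All X xs × C ⟦ xs ⟧ x)

IsFiniteConsequenceOp : {L : Set} → Op L → Set₁
IsFiniteConsequenceOp C = IsConsequenceOp C × IsFiniteOp C

_≤ₒ_ : {L : Set} → Op L → Op L → Set₁
C₁ ≤ₒ C₂ = ∀ X → C₁ X ⊆ C₂ X

_≈ₒ_ : {L : Set} → Op L → Op L → Set₁
C₁ ≈ₒ C₂ = ∀ X → C₁ X ≐ C₂ X

Iₒ : {L : Set} → Op L
Iₒ X = X

_∧ₒ_ : {L : Set} → Op L → Op L → Op L
(C₁ ∧ₒ C₂) X = C₁ X ∩ C₂ X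

_∨ₒ_ : {L : Set} → Op L → Op L → Op L
(C₁ ∨ₒ C₂) X = C₁ X ∪ C₂ X

-- The join ∨_w: (C₁ ∨_w C₂)(X) = ⋂ { Y : X ⊆ Y, Y = C₁(Y) = C₂(Y) }.
-- (Quantifying over all Y ⊆ L raises the universe level of the result.)
_∨w_ : {L : Set} → Op L → Op L → Sub L → Pred L (lsuc 0ℓ)
_∨w_ {L} C₁ C₂ X = λ x → ∀ (Y : Sub L) → X ⊆ Y → C₁ Y ≐ Y → C₂ Y ≐ Y → Y x

CB : {L : Set} → Sub L → Sub L → Op L
CB X B A = λ x → (¬ Empty (A ∩ B) → (A ∪ X) x) × (Empty (A ∩ B) → A x)

-- The operator C(X,B) either fixes A or adds all of X to it, depending only on whether A meets B,
-- and neither case changes whether A meets B. Classically this gives the normal form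
-- C(X,B)(A) = A ∪ {x ∈ X : A meets B}, from which the consequence-operator laws are immediate and
-- X ↦ C(X,B) turns ∩, ∪, arbitrary unions and intersections of the parameters into the
-- corresponding operations on operators; the smallest set above A closed under C(X,B) and C(Y,B)
-- is C(X ∪ Y,B)(A), whence ∨ = ∨_w. Evaluating at A = B shows C(X,B) ≤ C(Y,B) forces X ⊆ B ∪ Y,
-- so two singletons {c}, {d} with c ∉ A and d ∈ A ∖ B give incomparable operators.
module Submission where

open import Defs
open import Level using (0ℓ) renaming (suc to lsuc)
open import Axiom.ExcludedMiddle using (ExcludedMiddle)
open import Axiom.DoubleNegationElimination using (em⇒dne)
open import Data.Empty using (⊥-elim)
open import Data.List using (List; [_])
open import Data.List.Relation.Unary.All using (All; lookup; []; _∷_)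
open import Data.List.Relation.Unary.Any using (here)
open import Data.Product using (Σ; _×_; _,_; proj₁; proj₂)
open import Data.Product.Algebra using (×-distribˡ-⊎)
open import Data.Sum using (_⊎_; inj₁; inj₂; [_,_]′; map₂)
open import Function.Bundles using (Inverse)
open import Relation.Binary.PropositionalEquality using (refl; sym; subst)
open import Relation.Nullary using (¬_; yes; no)
open import Relation.Nullary.Decidable using (True; toWitness; fromWitness)
open import Relation.Unary.Properties using (⊆-U; ≐-sym; ≐-trans)
open import Relation.Unary using (_⊆_; _≐_; Satisfiable; U; Empty; _∩_; _∪_; ∅; ｛_｝; ⋃; ⋂)

∧ₒ-distribˡ-∨ₒ : {L : Set} (C₁ C₂ C₃ : Op L) →
                 (C₁ ∧ₒ (C₂ ∨ₒ C₃)) ≈ₒ ((C₁ ∧ₒ C₂) ∨ₒ (C₁ ∧ₒ C₃))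
∧ₒ-distribˡ-∨ₒ C₁ C₂ C₃ X =
  (λ {x} → Inverse.to (×-distribˡ-⊎ 0ℓ (C₁ X x) (C₂ X x) (C₃ X x))) ,
  (λ {x} → Inverse.from (×-distribˡ-⊎ 0ℓ (C₁ X x) (C₂ X x) (C₃ X x)))

module CB-Properties {L : Set} (B : Sub L) where

  Meets : Sub L → Set
  Meets A = ¬ Empty (A ∩ B)

  Satisfiable⇒Meets : {A : Sub L} → Satisfiable (A ∩ B) → Meets A
  Satisfiable⇒Meets (b , ab) empty = empty b ab

  Meets-mono : {A A′ : Sub L} → A ⊆ A′ → Meets A → Meets A′
  Meets-mono A⊆A′ meets empty = meets λ x (a , b) → empty x (A⊆A′ a , b)

  CB-intro : ∀ X A {x} → A x ⊎ (Meets A × X x) → CB X B A x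
  CB-intro X A (inj₁ a)        = (λ _ → inj₁ a) , (λ _ → a)
  CB-intro X A (inj₂ (m , xx)) = (λ _ → inj₂ xx) , (λ empty → ⊥-elim (m empty))

  CB-extensive : ∀ X A → A ⊆ CB X B A
  CB-extensive X A a = CB-intro X A (inj₁ a)

  CB-monoˡ : ∀ X X′ A → X ⊆ X′ → CB X B A ⊆ CB X′ B A
  CB-monoˡ X X′ A X⊆X′ (add , keep) = (λ m → map₂ X⊆X′ (add m)) , keep

  Meets-CB : ∀ X A → Meets (CB X B A) → Meets A
  Meets-CB X A meets empty = meets λ x (p , b) → empty x (proj₂ p empty , b)

  module Classical (em : ExcludedMiddle 0ℓ) where

    Meets⇒Satisfiable : {A : Sub L} → Meets A → Satisfiable (A ∩ B)
    Meets⇒Satisfiable meets = em⇒dne em λ none → meets λ x p → none (x , p)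

    CB-elim : ∀ X A {x} → CB X B A x → A x ⊎ (Meets A × X x)
    CB-elim X A (add , keep) with em {Empty (A ∩ B)}
    ... | yes empty = inj₁ (keep empty)
    ... | no meets  = map₂ (meets ,_) (add meets)

    CB-≤ₒ : ∀ {X Y} → (∀ {A} → Meets A → X ⊆ CB Y B A) → CB X B ≤ₒ CB Y B
    CB-≤ₒ {X} {Y} X⊆ A p = [ CB-extensive Y A , (λ (m , xx) → X⊆ m xx) ]′ (CB-elim X A p)

    CB-≤ₒ⇒⊆ : ∀ {X Y} → Meets B → CB X B ≤ₒ CB Y B → X ⊆ B ∪ Y
    CB-≤ₒ⇒⊆ {X} {Y} meets X≤Y xx = map₂ proj₂ (CB-elim Y B (X≤Y B (CB-intro X B (inj₂ (meets , xx)))))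

    CB-idempotent : ∀ X A → CB X B (CB X B A) ⊆ CB X B A
    CB-idempotent X A p with CB-elim X (CB X B A) p
    ... | inj₁ q        = q
    ... | inj₂ (m , xx) = CB-intro X A (inj₂ (Meets-CB X A m , xx))

    CB-monotone : ∀ X {A A′} → A ⊆ A′ → CB X B A ⊆ CB X B A′
    CB-monotone X {A} {A′} A⊆A′ p with CB-elim X A p
    ... | inj₁ a        = CB-extensive X A′ (A⊆A′ a)
    ... | inj₂ (m , xx) = CB-intro X A′ (inj₂ (Meets-mono A⊆A′ m , xx))

    -- A single element of A ∩ B is the finite subset that switches X on.
    CB-compact : ∀ X A {x} → CB X B A x → Σ (List L) λ xs → All A xs × CB X B ⟦ xs ⟧ x
    CB-compact X A {x} p with CB-elim X A p
    ... | inj₁ a = [ x ] , a ∷ [] , CB-extensive X ⟦ [ x ] ⟧ (here refl)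
    ... | inj₂ (m , xx) with Meets⇒Satisfiable m
    ...   | b , ab , bb = [ b ] , ab ∷ [] , CB-intro X ⟦ [ b ] ⟧ (inj₂ (Satisfiable⇒Meets (b , here refl , bb) , xx))

    CB-finiteConsequenceOp : ∀ X → IsFiniteConsequenceOp (CB X B)
    CB-finiteConsequenceOp X =
      record { extensive  = CB-extensive X
             ; idempotent = λ A → CB-idempotent X A , CB-extensive X (CB X B A)
             ; monotone   = λ _ _ → CB-monotone X } ,
      λ A → CB-compact X A , λ (xs , all , p) → CB-monotone X (lookup all) p

    CB-∅ : CB ∅ B ≈ₒ Iₒ
    CB-∅ A = (λ p → [ (λ a → a) , (λ ()) ]′ (CB-elim ∅ A p)) , CB-extensive ∅ A

    CB-∩ : ∀ X Y → CB (X ∩ Y) B ≈ₒ (CB X B ∧ₒ CB Y B)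
    CB-∩ X Y A = (λ p → CB-monoˡ (X ∩ Y) X A proj₁ p , CB-monoˡ (X ∩ Y) Y A proj₂ p) , from
      where
      from : (CB X B ∧ₒ CB Y B) A ⊆ CB (X ∩ Y) B A
      from (p , q) with CB-elim X A p | CB-elim Y A q
      ... | inj₁ a        | _             = CB-extensive (X ∩ Y) A a
      ... | _             | inj₁ a        = CB-extensive (X ∩ Y) A a
      ... | inj₂ (m , xx) | inj₂ (_ , yy) = CB-intro (X ∩ Y) A (inj₂ (m , xx , yy))

    CB-∪ : ∀ X Y → CB (X ∪ Y) B ≈ₒ (CB X B ∨ₒ CB Y B)
    CB-∪ X Y A = to , [ CB-monoˡ X (X ∪ Y) A inj₁ , CB-monoˡ Y (X ∪ Y) A inj₂ ]′
      where
      to : CB (X ∪ Y) B A ⊆ (CB X B ∨ₒ CB Y B) A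
      to p with CB-elim (X ∪ Y) A p
      ... | inj₁ a               = inj₁ (CB-extensive X A a)
      ... | inj₂ (m , inj₁ xx)   = inj₁ (CB-intro X A (inj₂ (m , xx)))
      ... | inj₂ (m , inj₂ yy)   = inj₂ (CB-intro Y A (inj₂ (m , yy)))

    CB-⊆-fixedPoint : ∀ X {A S} → A ⊆ S → CB X B S ≐ S → CB X B A ⊆ S
    CB-⊆-fixedPoint X A⊆S closed p = proj₁ closed (CB-monotone X A⊆S p)

    CB-fixes-larger : ∀ {X Y} A → X ⊆ Y → CB X B (CB Y B A) ≐ CB Y B A
    CB-fixes-larger {X} {Y} A X⊆Y =
      (λ p → CB-idempotent Y A (CB-monoˡ X Y (CB Y B A) X⊆Y p)) , CB-extensive X (CB Y B A)

    CB-∪-≐-∨w : ∀ X Y A → CB (X ∪ Y) B A ≐ (CB X B ∨w CB Y B) A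
    CB-∪-≐-∨w X Y A = to , from
      where
      to : CB (X ∪ Y) B A ⊆ (CB X B ∨w CB Y B) A
      to p S A⊆S closedX closedY =
        [ CB-⊆-fixedPoint X A⊆S closedX , CB-⊆-fixedPoint Y A⊆S closedY ]′ (proj₁ (CB-∪ X Y A) p)
      from : (CB X B ∨w CB Y B) A ⊆ CB (X ∪ Y) B A
      from h = h (CB (X ∪ Y) B A) (CB-extensive (X ∪ Y) A)
                 (CB-fixes-larger A inj₁) (CB-fixes-larger A inj₂)

    CB-∨ₒ-≐-∨w : ∀ X Y A → (CB X B ∨ₒ CB Y B) A ≐ (CB X B ∨w CB Y B) A
    CB-∨ₒ-≐-∨w X Y A = ≐-trans (≐-sym (CB-∪ X Y A)) (CB-∪-≐-∨w X Y A)

    -- ⋃ and ⋂ over an index in Set₁ land in Set₁; excluded middle at that level squashes them back into Sub L.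
    module Complete (em₁ : ExcludedMiddle (lsuc 0ℓ)) (Idx : Set₁) (Xs : Idx → Sub L) where

      ⋃↓ : Sub L
      ⋃↓ x = True (em₁ {⋃ Idx Xs x})

      ⋂↓ : Sub L
      ⋂↓ x = True (em₁ {⋂ Idx Xs x})

      CB-⋃↓-upper : ∀ i → CB (Xs i) B ≤ₒ CB ⋃↓ B
      CB-⋃↓-upper i A = CB-monoˡ (Xs i) ⋃↓ A λ xx → fromWitness (i , xx)

      CB-⋃↓-least : ∀ Y → (∀ i → CB (Xs i) B ≤ₒ CB Y B) → CB ⋃↓ B ≤ₒ CB Y B
      CB-⋃↓-least Y upper = CB-≤ₒ λ {A} m x∈⋃ → via-witness A m (toWitness x∈⋃)
        where
        via-witness : ∀ A {x} → Meets A → ⋃ Idx Xs x → CB Y B A x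
        via-witness A m (i , xx) = upper i A (CB-intro (Xs i) A (inj₂ (m , xx)))

      CB-⋂↓-lower : ∀ i → CB ⋂↓ B ≤ₒ CB (Xs i) B
      CB-⋂↓-lower i A = CB-monoˡ ⋂↓ (Xs i) A λ x∈⋂ → toWitness x∈⋂ i

      CB-⋂↓-greatest : ∀ Y → (∀ i → CB Y B ≤ₒ CB (Xs i) B) → CB Y B ≤ₒ CB ⋂↓ B
      CB-⋂↓-greatest Y lower = CB-≤ₒ λ {A} m yy → CB-⋂↓-intro A m (λ i → lower i A (CB-intro Y A (inj₂ (m , yy))))
        where
        CB-⋂↓-intro : ∀ A {x} → Meets A → (∀ i → CB (Xs i) B A x) → CB ⋂↓ B A x
        CB-⋂↓-intro A {x} m inXs with em {A x}
        ... | yes a  = CB-extensive ⋂↓ A a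
        ... | no ¬a = CB-intro ⋂↓ A (inj₂ (m , fromWitness λ i →
                        [ (λ a → ⊥-elim (¬a a)) , proj₂ ]′ (CB-elim (Xs i) A (inXs i))))

    ¬⊆⇒Satisfiable : {P Q : Sub L} → ¬ (P ⊆ Q) → Satisfiable λ x → P x × ¬ Q x
    ¬⊆⇒Satisfiable P⊈Q = em⇒dne em λ none → P⊈Q λ {x} p → em⇒dne em λ ¬q → none (x , p , ¬q)

    CB-singletons-incomparable : ∀ {A : Sub L} → Meets B → B ⊆ A → ∀ {c d : L} → ¬ A c → A d → ¬ B d →
                                 ¬ ((CB ｛ c ｝ B ≤ₒ CB ｛ d ｝ B) ⊎ (CB ｛ d ｝ B ≤ₒ CB ｛ c ｝ B))
    CB-singletons-incomparable {A} meets B⊆A ¬Ac Ad ¬Bd (inj₁ c≤d) =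
      [ (λ Bc → ¬Ac (B⊆A Bc)) , (λ d≡c → ¬Ac (subst A d≡c Ad)) ]′ (CB-≤ₒ⇒⊆ meets c≤d refl)
    CB-singletons-incomparable {A} meets B⊆A ¬Ac Ad ¬Bd (inj₂ d≤c) =
      [ ¬Bd , (λ c≡d → ¬Ac (subst A (sym c≡d) Ad)) ]′ (CB-≤ₒ⇒⊆ meets d≤c refl)

    CB-not-total : ∀ {A : Sub L} → Satisfiable B → ¬ (A ≐ U) → B ⊆ A → ¬ (B ≐ A) →
                   ¬ (∀ X Y → (CB X B ≤ₒ CB Y B) ⊎ (CB Y B ≤ₒ CB X B))
    CB-not-total {A} (b , Bb) A≉U B⊆A B≉A total
      with ¬⊆⇒Satisfiable {U} {A} (λ U⊆A → A≉U (⊆-U A , U⊆A))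
         | ¬⊆⇒Satisfiable {A} {B} (λ A⊆B → B≉A (B⊆A , A⊆B))
    ... | c , _ , ¬Ac | d , Ad , ¬Bd =
      CB-singletons-incomparable (Satisfiable⇒Meets (b , Bb , Bb)) B⊆A ¬Ac Ad ¬Bd (total ｛ c ｝ ｛ d ｝)

theorem3p1 : ExcludedMiddle 0ℓ → ExcludedMiddle (lsuc 0ℓ) →
  (L : Set) → L → (B : Sub L) →
  -- 𝒞(B) ⊆ 𝒞_f
  (∀ X → IsFiniteConsequenceOp (CB X B))
  -- on 𝒞(B) the join ∨ coincides with ∨_w
  × (∀ X Y A → (CB X B ∨ₒ CB Y B) A ≐ (CB X B ∨w CB Y B) A)
  -- sublattice: closed under ∧, ∨ and ∨_w
  × (∀ X Y → Σ (Sub L) λ Z → CB Z B ≈ₒ (CB X B ∧ₒ CB Y B))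
  × (∀ X Y → Σ (Sub L) λ Z → CB Z B ≈ₒ (CB X B ∨ₒ CB Y B))
  × (∀ X Y → Σ (Sub L) λ Z → ∀ A → CB Z B A ≐ (CB X B ∨w CB Y B) A)
  -- I ∈ 𝒞(B) is its least element, C(L,B) its greatest element
  × (Σ (Sub L) λ Z → CB Z B ≈ₒ Iₒ)
  × (∀ X → Iₒ ≤ₒ CB X B)
  × (∀ X → CB X B ≤ₒ CB U B)
  -- complete: every subfamily of 𝒞(B) has a supremum and an infimum in 𝒞(B)
  × (∀ (Idx : Set₁) (Xs : Idx → Sub L) →
       (Σ (Sub L) λ Z → (∀ i → CB (Xs i) B ≤ₒ CB Z B)
          × (∀ Y → (∀ i → CB (Xs i) B ≤ₒ CB Y B) → CB Z B ≤ₒ CB Y B))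
       × (Σ (Sub L) λ W → (∀ i → CB W B ≤ₒ CB (Xs i) B)
          × (∀ Y → (∀ i → CB Y B ≤ₒ CB (Xs i) B) → CB Y B ≤ₒ CB W B)))
  -- distributive
  × (∀ X Y Z → (CB X B ∧ₒ (CB Y B ∨ₒ CB Z B))
                 ≈ₒ ((CB X B ∧ₒ CB Y B) ∨ₒ (CB X B ∧ₒ CB Z B)))
  -- not a chain, if ∅ ≠ B ⊊ A ⊊ L
  × (∀ (A : Sub L) → Satisfiable A → Satisfiable B → ¬ (A ≐ U) → B ⊆ A → ¬ (B ≐ A) →
       ¬ (∀ X Y → (CB X B ≤ₒ CB Y B) ⊎ (CB Y B ≤ₒ CB X B)))
theorem3p1 em em₁ L _ B =
  CB-finiteConsequenceOp , CB-∨ₒ-≐-∨w ,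
  (λ X Y → X ∩ Y , CB-∩ X Y) , (λ X Y → X ∪ Y , CB-∪ X Y) , (λ X Y → X ∪ Y , CB-∪-≐-∨w X Y) ,
  (∅ , CB-∅) , CB-extensive , (λ X A → CB-monoˡ X U A _) ,
  (λ Idx Xs → let open Complete em₁ Idx Xs in
     (⋃↓ , CB-⋃↓-upper , CB-⋃↓-least) , (⋂↓ , CB-⋂↓-lower , CB-⋂↓-greatest)) ,
  (λ X Y Z → ∧ₒ-distribˡ-∨ₒ (CB X B) (CB Y B) (CB Z B)) ,
  λ A _ → CB-not-total
  where open CB-Properties B
        open Classical em
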